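{- Let $n\in\mathbb{Z}$ be odd with $n\geq 3$. Then there exist two skew-symmetric integer matrices $B,B^\circ\in M_n(\mathbb{Z})$ such that (i) $B$ and $B^\circ$ are congruent over $\mathbb{Z}$, i.e. there exists a unimodular matrix $X\in M_n(\mathbb{Z})$ (integer entries, $\det X=\pm1$) with $B^\circ=XBX^t$; and (ii) $\delta(B)\not\equiv\delta(B^\circ)\pmod 4$.
   Context: For a skew-symmetric $B=(b_{ij})\in M_n(\mathbb{Z})$, let $V(B)\in M_n(\mathbb{Z})$ be the matrix with $V(B)_{ij}=b_{ij}$ if $i<j$, $V(B)_{ii}=1$, and $V(B)_{ij}=0$ if $i>j$. Set $\mathfrak{S}(B):=V(B)+V(B)^t$ and $\delta(B):=\det(\mathfrak{S}(B))\pmod 4$. -}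

module Defs where

open import Data.Nat using (ℕ; zero; suc)
open import Data.Fin using (Fin; zero; suc; punchIn; _<_)
open import Data.Integer using (ℤ; +_; -_; _+_; _*_; _-_)
open import Data.Integer.Divisibility using (_∣_)
open import Relation.Nullary using (¬_; yes; no)
open import Data.Fin.Properties using (_<?_)
open import Data.Fin using (_≟_)
open import Relation.Binary.PropositionalEquality using (_≡_)

Mat : ℕ → Set
Mat n = Fin n → Fin n → ℤ

transpose : ∀ {n} → Mat n → Mat n
transpose A i j = A j i

∑ : ∀ n → (Fin n → ℤ) → ℤ
∑ zero    f = + 0
∑ (suc n) f = f zero + ∑ n (λ i → f (suc i))

_⊗_ : ∀ {n} → Mat n → Mat n → Mat n
(A ⊗ B) i j = ∑ _ (λ k → A i k * B k j)

_⊕_ : ∀ {n} → Mat n → Mat n → Mat n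
(A ⊕ B) i j = A i j + B i j

sgn : ℕ → ℤ
sgn zero = + 1
sgn (suc zero) = - (+ 1)
sgn (suc (suc k)) = sgn k

minor : ∀ {n} → Mat (suc n) → Fin (suc n) → Mat n
minor A j r c = A (suc r) (punchIn j c)

det : ∀ {n} → Mat n → ℤ
det {zero}  A = + 1
det {suc n} A = ∑ (suc n) (λ j → sgn (Data.Fin.toℕ j) * (A zero j * det (minor A j)))

SkewSymmetric : ∀ {n} → Mat n → Set
SkewSymmetric B = ∀ i j → B j i ≡ - B i j

V : ∀ {n} → Mat n → Mat n
V B i j with i <? j
... | yes _ = B i j
... | no _ with i ≟ j
...   | yes _ = + 1
...   | no _  = + 0

𝔖 : ∀ {n} → Mat n → Mat n
𝔖 B = V B ⊕ transpose (V B)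

Unimodular : ∀ {n} → Mat n → Set
Unimodular X = (det X ≡ + 1) ⊎' (det X ≡ - (+ 1))
  where open import Data.Sum using () renaming (_⊎_ to _⊎'_)

CongruentOverℤ : ∀ {n} → Mat n → Mat n → Set
CongruentOverℤ {n} B B° =
  Σ' (Mat n) (λ X → Unimodular X × (∀ i j → B° i j ≡ ((X ⊗ B) ⊗ transpose X) i j))
  where open import Data.Product using (_×_) renaming (Σ to Σ')

δ-differ : ∀ {n} → Mat n → Mat n → Set
δ-differ B B° = ¬ ((+ 4) ∣ (det (𝔖 B) - det (𝔖 B°)))

{-# OPTIONS --safe #-}
-- For n = 3, B = [[0,1,0],[-1,0,0],[0,0,0]] and its unimodular congruent B° = X B Xᵗ
-- satisfy det 𝔖(B) = 6 and det 𝔖(B°) = 4. Putting the block J = [[0,1],[-1,0]] in front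
-- of both (and I₂ in front of X) preserves skew-symmetry and congruence, and multiplies
-- both determinants by det 𝔖(J) = 3, which is prime to 4; so the difference of the
-- determinants is never divisible by 4, in every odd dimension n ≥ 3.
module Submission where

open import Defs
open import Data.Nat as ℕ using (ℕ; zero; suc; _≤_; _%_; s≤s; z≤n)
open import Data.Nat.Divisibility using (_∣?_) renaming (_∣_ to _∣ℕ_)
open import Data.Nat.Coprimality using (Coprime; coprime?; coprime-divisor)
open import Data.Fin using (Fin; zero; suc; _<_; toℕ; punchIn)
open import Data.Fin.Properties using (_<?_; _≟_; suc-injective; <-irrefl; all?)
open import Data.Integer using (ℤ; +_; -_; _+_; _*_; _-_; ∣_∣)
open import Data.Integer.Divisibility using (_∣_)
open import Data.Integer.Properties using (*-zeroʳ; *-identityˡ; +-identityˡ; +-identityʳ; abs-*) renaming (_≟_ to _≟ℤ_)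
open import Data.Integer.Tactic.RingSolver using (solve-∀)
open import Data.Product using (Σ; _×_; _,_)
import Data.Sum as Sum
open import Data.Empty using (⊥-elim)
open import Relation.Nullary using (¬_; yes; no)
open import Relation.Nullary.Decidable using (from-yes; from-no)
open import Data.Vec using (Vec; []; _∷_; lookup)
open import Relation.Binary.PropositionalEquality using (_≡_; _≢_; refl; sym; trans; cong; cong₂; subst; module ≡-Reasoning)

infix 4 _≈_
_≈_ : ∀ {n} → Mat n → Mat n → Set
A ≈ B = ∀ i j → A i j ≡ B i j

∑-cong : ∀ n {f g : Fin n → ℤ} → (∀ i → f i ≡ g i) → ∑ n f ≡ ∑ n g
∑-cong zero    f≡g = refl
∑-cong (suc n) f≡g = cong₂ _+_ (f≡g zero) (∑-cong n (λ i → f≡g (suc i)))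

∑-zero : ∀ n {f : Fin n → ℤ} → (∀ i → f i ≡ + 0) → ∑ n f ≡ + 0
∑-zero zero    f≡0 = refl
∑-zero (suc n) f≡0 = cong₂ _+_ (f≡0 zero) (∑-zero n (λ i → f≡0 (suc i)))

det-cong : ∀ {n} {A B : Mat n} → A ≈ B → det A ≡ det B
det-cong {zero}  A≈B = refl
det-cong {suc n} A≈B = ∑-cong (suc n) λ j → cong (sgn (toℕ j) *_)
  (cong₂ _*_ (A≈B zero j) (det-cong (λ r c → A≈B (suc r) (punchIn j c))))

⊗-cong : ∀ {n} {A A′ B B′ : Mat n} → A ≈ A′ → B ≈ B′ → A ⊗ B ≈ A′ ⊗ B′
⊗-cong {n} A≈A′ B≈B′ i j = ∑-cong n (λ k → cong₂ _*_ (A≈A′ i k) (B≈B′ k j))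

det-headRow₁ : ∀ {n} (A : Mat (suc n)) → (∀ j → A zero (suc j) ≡ + 0) →
  det A ≡ A zero zero * det (minor A zero)
det-headRow₁ {n} A row≡0 = begin
  + 1 * (a * d) + ∑ n (λ j → sgn (suc (toℕ j)) * (A zero (suc j) * det (minor A (suc j))))
    ≡⟨ cong₂ _+_ (*-identityˡ (a * d)) (∑-zero n vanish) ⟩
  a * d + + 0 ≡⟨ +-identityʳ (a * d) ⟩
  a * d ∎
  where
  open ≡-Reasoning
  a = A zero zero
  d = det (minor A zero)
  vanish : ∀ j → sgn (suc (toℕ j)) * (A zero (suc j) * det (minor A (suc j))) ≡ + 0
  vanish j rewrite row≡0 j = *-zeroʳ (sgn (suc (toℕ j)))

det-headRow₂ : ∀ {n} (A : Mat (suc (suc n))) → (∀ j → A zero (suc (suc j)) ≡ + 0) →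
  det A ≡ A zero zero * det (minor A zero) - A zero (suc zero) * det (minor A (suc zero))
det-headRow₂ {n} A row≡0 = begin
  + 1 * (a * d) + (- (+ 1) * (b * e) + ∑ n (λ j → sgn (toℕ j) * (A zero (suc (suc j)) * det (minor A (suc (suc j))))))
    ≡⟨ cong (λ t → + 1 * (a * d) + (- (+ 1) * (b * e) + t)) (∑-zero n vanish) ⟩
  + 1 * (a * d) + (- (+ 1) * (b * e) + + 0) ≡⟨ expand a b d e ⟩
  a * d - b * e ∎
  where
  open ≡-Reasoning
  a = A zero zero
  b = A zero (suc zero)
  d = det (minor A zero)
  e = det (minor A (suc zero))
  vanish : ∀ j → sgn (toℕ j) * (A zero (suc (suc j)) * det (minor A (suc (suc j)))) ≡ + 0
  vanish j rewrite row≡0 j = *-zeroʳ (sgn (toℕ j))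
  expand : ∀ a b d e → + 1 * (a * d) + (- (+ 1) * (b * e) + + 0) ≡ a * d - b * e
  expand = solve-∀

det₂ : Mat 2 → ℤ
det₂ P = P zero zero * P (suc zero) (suc zero) - P zero (suc zero) * P (suc zero) zero

infixr 6 _⊞_
_⊞_ : ∀ {n} → Mat 2 → Mat n → Mat (suc (suc n))
(P ⊞ M) zero          zero          = P zero zero
(P ⊞ M) zero          (suc zero)    = P zero (suc zero)
(P ⊞ M) (suc zero)    zero          = P (suc zero) zero
(P ⊞ M) (suc zero)    (suc zero)    = P (suc zero) (suc zero)
(P ⊞ M) (suc (suc i)) (suc (suc j)) = M i j
(P ⊞ M) zero          (suc (suc j)) = + 0
(P ⊞ M) (suc zero)    (suc (suc j)) = + 0
(P ⊞ M) (suc (suc i)) zero          = + 0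
(P ⊞ M) (suc (suc i)) (suc zero)    = + 0

⊞-cong : ∀ {n} {P P′ : Mat 2} {M M′ : Mat n} → P ≈ P′ → M ≈ M′ → P ⊞ M ≈ P′ ⊞ M′
⊞-cong P≈P′ M≈M′ zero          zero          = P≈P′ _ _
⊞-cong P≈P′ M≈M′ zero          (suc zero)    = P≈P′ _ _
⊞-cong P≈P′ M≈M′ (suc zero)    zero          = P≈P′ _ _
⊞-cong P≈P′ M≈M′ (suc zero)    (suc zero)    = P≈P′ _ _
⊞-cong P≈P′ M≈M′ (suc (suc i)) (suc (suc j)) = M≈M′ i j
⊞-cong P≈P′ M≈M′ zero          (suc (suc j)) = refl
⊞-cong P≈P′ M≈M′ (suc zero)    (suc (suc j)) = refl
⊞-cong P≈P′ M≈M′ (suc (suc i)) zero          = refl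
⊞-cong P≈P′ M≈M′ (suc (suc i)) (suc zero)    = refl

det-⊞ : ∀ {n} (P : Mat 2) (M : Mat n) → det (P ⊞ M) ≡ det₂ P * det M
det-⊞ P M = begin
  det (P ⊞ M)
    ≡⟨ det-headRow₂ (P ⊞ M) (λ j → refl) ⟩
  p₀₀ * det (minor (P ⊞ M) zero) - p₀₁ * det (minor (P ⊞ M) (suc zero))
    ≡⟨ cong₂ (λ x y → p₀₀ * x - p₀₁ * y)
         (det-headRow₁ (minor (P ⊞ M) zero) (λ j → refl))
         (det-headRow₁ (minor (P ⊞ M) (suc zero)) (λ j → refl)) ⟩
  p₀₀ * (p₁₁ * det M) - p₀₁ * (p₁₀ * det M)
    ≡⟨ factor p₀₀ p₁₁ p₀₁ p₁₀ (det M) ⟩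
  det₂ P * det M ∎
  where
  open ≡-Reasoning
  p₀₀ = P zero zero
  p₀₁ = P zero (suc zero)
  p₁₀ = P (suc zero) zero
  p₁₁ = P (suc zero) (suc zero)
  factor : ∀ a b c d m → a * (b * m) - c * (d * m) ≡ (a * b - c * d) * m
  factor = solve-∀

transpose-⊞ : ∀ {n} (P : Mat 2) (M : Mat n) → transpose (P ⊞ M) ≈ transpose P ⊞ transpose M
transpose-⊞ P M zero          zero          = refl
transpose-⊞ P M zero          (suc zero)    = refl
transpose-⊞ P M (suc zero)    zero          = refl
transpose-⊞ P M (suc zero)    (suc zero)    = refl
transpose-⊞ P M (suc (suc i)) (suc (suc j)) = refl
transpose-⊞ P M zero          (suc (suc j)) = refl
transpose-⊞ P M (suc zero)    (suc (suc j)) = refl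
transpose-⊞ P M (suc (suc i)) zero          = refl
transpose-⊞ P M (suc (suc i)) (suc zero)    = refl

⊞-⊗ : ∀ {n} (P Q : Mat 2) (M N : Mat n) → (P ⊞ M) ⊗ (Q ⊞ N) ≈ (P ⊗ Q) ⊞ (M ⊗ N)
⊞-⊗ {n} P Q M N = entry
  where
  ∑0 : ∑ n (λ k → + 0) ≡ + 0
  ∑0 = ∑-zero n (λ k → refl)
  upperLeft : ∀ a b → a + (b + ∑ n (λ k → + 0)) ≡ a + (b + + 0)
  upperLeft a b = cong (λ t → a + (b + t)) ∑0
  upperRight : ∀ a b → a * + 0 + (b * + 0 + ∑ n (λ k → + 0)) ≡ + 0
  upperRight a b rewrite ∑0 | *-zeroʳ a | *-zeroʳ b = refl
  lower : ∀ i → + 0 + (+ 0 + ∑ n (λ k → M i k * + 0)) ≡ + 0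
  lower i = trans (+-identityˡ _) (trans (+-identityˡ _) (∑-zero n (λ k → *-zeroʳ (M i k))))
  entry : (P ⊞ M) ⊗ (Q ⊞ N) ≈ (P ⊗ Q) ⊞ (M ⊗ N)
  entry zero          zero          = upperLeft (P zero zero * Q zero zero) (P zero (suc zero) * Q (suc zero) zero)
  entry zero          (suc zero)    = upperLeft (P zero zero * Q zero (suc zero)) (P zero (suc zero) * Q (suc zero) (suc zero))
  entry (suc zero)    zero          = upperLeft (P (suc zero) zero * Q zero zero) (P (suc zero) (suc zero) * Q (suc zero) zero)
  entry (suc zero)    (suc zero)    = upperLeft (P (suc zero) zero * Q zero (suc zero)) (P (suc zero) (suc zero) * Q (suc zero) (suc zero))
  entry (suc (suc i)) (suc (suc j)) = trans (+-identityˡ _) (+-identityˡ _)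
  entry zero          (suc (suc j)) = upperRight (P zero zero) (P zero (suc zero))
  entry (suc zero)    (suc (suc j)) = upperRight (P (suc zero) zero) (P (suc zero) (suc zero))
  entry (suc (suc i)) zero          = lower i
  entry (suc (suc i)) (suc zero)    = lower i

V-< : ∀ {n} (B : Mat n) i j → i < j → V B i j ≡ B i j
V-< B i j i<j with i <? j
... | yes _   = refl
... | no  i≮j = ⊥-elim (i≮j i<j)

V-≡ : ∀ {n} (B : Mat n) i → V B i i ≡ + 1
V-≡ B i with i <? i
... | yes i<i = ⊥-elim (<-irrefl refl i<i)
... | no _ with i ≟ i
...   | yes _   = refl
...   | no  i≢i = ⊥-elim (i≢i refl)

V-> : ∀ {n} (B : Mat n) i j → ¬ i < j → i ≢ j → V B i j ≡ + 0
V-> B i j i≮j i≢j with i <? j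
... | yes i<j = ⊥-elim (i≮j i<j)
... | no _ with i ≟ j
...   | yes i≡j = ⊥-elim (i≢j i≡j)
...   | no _    = refl

V-suc : ∀ {n} (B : Mat (suc n)) i j → V B (suc i) (suc j) ≡ V (λ a b → B (suc a) (suc b)) i j
V-suc B i j with i <? j
... | yes i<j = V-< B (suc i) (suc j) (s≤s i<j)
... | no  i≮j with i ≟ j
...   | yes refl = V-≡ B (suc i)
...   | no  i≢j  = V-> B (suc i) (suc j) (λ { (s≤s i<j) → i≮j i<j }) (λ si≡sj → i≢j (suc-injective si≡sj))

V-⊞ : ∀ {n} (P : Mat 2) (M : Mat n) → V (P ⊞ M) ≈ V P ⊞ V M
V-⊞ P M zero          zero          = refl
V-⊞ P M zero          (suc zero)    = refl
V-⊞ P M (suc zero)    zero          = refl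
V-⊞ P M (suc zero)    (suc zero)    = refl
V-⊞ P M (suc (suc i)) (suc (suc j)) =
  trans (V-suc (P ⊞ M) (suc i) (suc j)) (V-suc (λ a b → (P ⊞ M) (suc a) (suc b)) i j)
V-⊞ P M zero          (suc (suc j)) = refl
V-⊞ P M (suc zero)    (suc (suc j)) = refl
V-⊞ P M (suc (suc i)) zero          = refl
V-⊞ P M (suc (suc i)) (suc zero)    = refl

𝔖-⊞ : ∀ {n} (P : Mat 2) (M : Mat n) → 𝔖 (P ⊞ M) ≈ 𝔖 P ⊞ 𝔖 M
𝔖-⊞ P M i j = begin
  V (P ⊞ M) i j + V (P ⊞ M) j i
    ≡⟨ cong₂ _+_ (V-⊞ P M i j) (trans (V-⊞ P M j i) (transpose-⊞ (V P) (V M) i j)) ⟩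
  ((V P ⊞ V M) ⊕ (transpose (V P) ⊞ transpose (V M))) i j
    ≡⟨ sum i j ⟩
  (𝔖 P ⊞ 𝔖 M) i j ∎
  where
  open ≡-Reasoning
  sum : (V P ⊞ V M) ⊕ (transpose (V P) ⊞ transpose (V M)) ≈ 𝔖 P ⊞ 𝔖 M
  sum zero          zero          = refl
  sum zero          (suc zero)    = refl
  sum (suc zero)    zero          = refl
  sum (suc zero)    (suc zero)    = refl
  sum (suc (suc i)) (suc (suc j)) = refl
  sum zero          (suc (suc j)) = refl
  sum (suc zero)    (suc (suc j)) = refl
  sum (suc (suc i)) zero          = refl
  sum (suc (suc i)) (suc zero)    = refl

skew-⊞ : ∀ {n} {P : Mat 2} {M : Mat n} → SkewSymmetric P → SkewSymmetric M → SkewSymmetric (P ⊞ M)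
skew-⊞ skewP skewM zero          zero          = skewP _ _
skew-⊞ skewP skewM zero          (suc zero)    = skewP _ _
skew-⊞ skewP skewM (suc zero)    zero          = skewP _ _
skew-⊞ skewP skewM (suc zero)    (suc zero)    = skewP _ _
skew-⊞ skewP skewM (suc (suc i)) (suc (suc j)) = skewM i j
skew-⊞ skewP skewM zero          (suc (suc j)) = refl
skew-⊞ skewP skewM (suc zero)    (suc (suc j)) = refl
skew-⊞ skewP skewM (suc (suc i)) zero          = refl
skew-⊞ skewP skewM (suc (suc i)) (suc zero)    = refl

I₂ : Mat 2
I₂ zero       zero       = + 1
I₂ zero       (suc zero) = + 0
I₂ (suc zero) zero       = + 0
I₂ (suc zero) (suc zero) = + 1

conjugate-I₂ : (P : Mat 2) → (I₂ ⊗ P) ⊗ transpose I₂ ≈ P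
conjugate-I₂ P zero       zero       = entry (P zero zero)       (P zero (suc zero))       (P (suc zero) zero)       (P (suc zero) (suc zero))
  where entry : ∀ a b c d → (+ 1 * a + (+ 0 * c + + 0)) * + 1 + ((+ 1 * b + (+ 0 * d + + 0)) * + 0 + + 0) ≡ a
        entry = solve-∀
conjugate-I₂ P zero       (suc zero) = entry (P zero zero)       (P zero (suc zero))       (P (suc zero) zero)       (P (suc zero) (suc zero))
  where entry : ∀ a b c d → (+ 1 * a + (+ 0 * c + + 0)) * + 0 + ((+ 1 * b + (+ 0 * d + + 0)) * + 1 + + 0) ≡ b
        entry = solve-∀
conjugate-I₂ P (suc zero) zero       = entry (P zero zero)       (P zero (suc zero))       (P (suc zero) zero)       (P (suc zero) (suc zero))
  where entry : ∀ a b c d → (+ 0 * a + (+ 1 * c + + 0)) * + 1 + ((+ 0 * b + (+ 1 * d + + 0)) * + 0 + + 0) ≡ c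
        entry = solve-∀
conjugate-I₂ P (suc zero) (suc zero) = entry (P zero zero)       (P zero (suc zero))       (P (suc zero) zero)       (P (suc zero) (suc zero))
  where entry : ∀ a b c d → (+ 0 * a + (+ 1 * c + + 0)) * + 0 + ((+ 0 * b + (+ 1 * d + + 0)) * + 1 + + 0) ≡ d
        entry = solve-∀

det-I₂⊞ : ∀ {n} (X : Mat n) → det (I₂ ⊞ X) ≡ det X
det-I₂⊞ X = trans (det-⊞ I₂ X) (*-identityˡ (det X))

unimodular-I₂⊞ : ∀ {n} {X : Mat n} → Unimodular X → Unimodular (I₂ ⊞ X)
unimodular-I₂⊞ {X = X} = Sum.map (trans (det-I₂⊞ X)) (trans (det-I₂⊞ X))

congruent-⊞ : ∀ {n} (P : Mat 2) {B B° : Mat n} → CongruentOverℤ B B° → CongruentOverℤ (P ⊞ B) (P ⊞ B°)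
congruent-⊞ P {B} {B°} (X , unimodular , B°≈XBXᵗ) = I₂ ⊞ X , unimodular-I₂⊞ {X = X} unimodular , λ i j → sym (begin
  (((I₂ ⊞ X) ⊗ (P ⊞ B)) ⊗ transpose (I₂ ⊞ X)) i j
    ≡⟨ ⊗-cong (⊞-⊗ I₂ P X B) (transpose-⊞ I₂ X) i j ⟩
  ((I₂ ⊗ P ⊞ X ⊗ B) ⊗ (transpose I₂ ⊞ transpose X)) i j
    ≡⟨ ⊞-⊗ (I₂ ⊗ P) (transpose I₂) (X ⊗ B) (transpose X) i j ⟩
  ((I₂ ⊗ P) ⊗ transpose I₂ ⊞ (X ⊗ B) ⊗ transpose X) i j
    ≡⟨ ⊞-cong (conjugate-I₂ P) (λ a b → sym (B°≈XBXᵗ a b)) i j ⟩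
  (P ⊞ B°) i j ∎)
  where open ≡-Reasoning

δ-differ-⊞ : ∀ {n} (P : Mat 2) {B B° : Mat n} →
  Coprime 4 ∣ det₂ (𝔖 P) ∣ → δ-differ B B° → δ-differ (P ⊞ B) (P ⊞ B°)
δ-differ-⊞ P {B} {B°} coprime differ 4∣c*d = differ (coprime-divisor coprime 4∣∣c∣*∣d∣)
  where
  c = det₂ (𝔖 P)
  d = det (𝔖 B) - det (𝔖 B°)
  det𝔖-⊞ : ∀ M → det (𝔖 (P ⊞ M)) ≡ c * det (𝔖 M)
  det𝔖-⊞ M = trans (det-cong (𝔖-⊞ P M)) (det-⊞ (𝔖 P) (𝔖 M))
  factor : ∀ c x y → c * x - c * y ≡ c * (x - y)
  factor = solve-∀
  4∣∣c∣*∣d∣ : 4 ∣ℕ ∣ c ∣ ℕ.* ∣ d ∣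
  4∣∣c∣*∣d∣ = subst (4 ∣ℕ_) (abs-* c d)
    (subst (λ z → + 4 ∣ z) (trans (cong₂ _-_ (det𝔖-⊞ B) (det𝔖-⊞ B°)) (factor c _ _)) 4∣c*d)

SkewCounterexample : ℕ → Set
SkewCounterexample n = Σ (Mat n) λ B → Σ (Mat n) λ B° →
  SkewSymmetric B × SkewSymmetric B° × CongruentOverℤ B B° × δ-differ B B°

fromRows : ∀ {n} → Vec (Vec ℤ n) n → Mat n
fromRows rows i j = lookup (lookup rows i) j

J : Mat 2
J = fromRows ((+ 0     ∷ + 1 ∷ []) ∷
              (- (+ 1) ∷ + 0 ∷ []) ∷ [])

counterexample-J⊞ : ∀ {n} → SkewCounterexample n → SkewCounterexample (suc (suc n))
counterexample-J⊞ (B , B° , skewB , skewB° , congruent , differ) =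
  J ⊞ B , J ⊞ B° , skew-⊞ skewJ skewB , skew-⊞ skewJ skewB° ,
  congruent-⊞ J congruent , δ-differ-⊞ J {B} {B°} (from-yes (coprime? 4 3)) differ
  where
  skewJ : SkewSymmetric J
  skewJ = from-yes (all? λ i → all? λ j → J j i ≟ℤ - J i j)

B₃ B₃° X₃ : Mat 3
B₃  = fromRows ((+ 0     ∷ + 1     ∷ + 0     ∷ []) ∷
                (- (+ 1) ∷ + 0     ∷ + 0     ∷ []) ∷
                (+ 0     ∷ + 0     ∷ + 0     ∷ []) ∷ [])
B₃° = fromRows ((+ 0     ∷ + 0     ∷ - (+ 1) ∷ []) ∷
                (+ 0     ∷ + 0     ∷ - (+ 1) ∷ []) ∷
                (+ 1     ∷ + 1     ∷ + 0     ∷ []) ∷ [])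
X₃  = fromRows ((- (+ 1) ∷ - (+ 1) ∷ - (+ 1) ∷ []) ∷
                (- (+ 1) ∷ - (+ 1) ∷ + 0     ∷ []) ∷
                (- (+ 1) ∷ + 0     ∷ - (+ 1) ∷ []) ∷ [])

counterexample₃ : SkewCounterexample 3
counterexample₃ =
  B₃ , B₃° ,
  from-yes (all? λ i → all? λ j → B₃ j i ≟ℤ - B₃ i j) ,
  from-yes (all? λ i → all? λ j → B₃° j i ≟ℤ - B₃° i j) ,
  (X₃ , Sum.inj₁ refl , from-yes (all? λ i → all? λ j → B₃° i j ≟ℤ ((X₃ ⊗ B₃) ⊗ transpose X₃) i j)) ,
  from-no (4 ∣? 2)

proposition1p7 : (n : ℕ) → n % 2 ≡ 1 → 3 ≤ n →
    Σ (Mat n) λ B → Σ (Mat n) λ B° →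
      SkewSymmetric B × SkewSymmetric B° × CongruentOverℤ B B° × δ-differ B B°
proposition1p7 0 () _
proposition1p7 1 _ (s≤s ())
proposition1p7 2 () _
proposition1p7 3 _ _ = counterexample₃
proposition1p7 4 () _
proposition1p7 (suc (suc n@(suc (suc (suc _))))) odd _ =
  counterexample-J⊞ (proposition1p7 n odd (s≤s (s≤s (s≤s z≤n))))
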